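{- Let $p$ be a prime, let $n$ be a positive integer, and let $k\ge0$ be an integer with $n<\sigma_{k+1}$. Then $$n=\sum_{j=0}^k b_j\sigma_j$$ for some integers $b_j$ with $0\le b_j\le p$ for $0\le j\le k$, such that if $b_j=p$ then $b_i=0$ for all $i<j$. Moreover, for any such representation, $$\lambda_p(n)=\sum_{j=0}^k b_j p^j.$$
   Context: For an integer $k\ge 0$, $\sigma_k=\sum_{j=0}^k p^j$. For $\vec v\in\mathbb{F}_p^n$, $\|\vec v\|$ denotes the number of nonzero coordinates. For a matrix $M$ over $\mathbb{F}_p$, its capacity is $c(M)=\max_{\vec v\in \mathrm{row}(M)}\|\vec v\|$, where $\mathrm{row}(M)$ is the $\mathbb{F}_p$-span of its rows. For $n\ge1$, $\mathcal{M}_n^*$ is the set of $m\times n$ matrices over $\mathbb{F}_p$ with $1\le m\le p^n$ and no zero column, and $\lambda_p(n)=\min_{M\in\mathcal{M}_n^*} c(M)$. -}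

module Defs where

open import Data.Nat using (ℕ; zero; suc; _+_; _*_; _^_; _≤_; _<_)
open import Data.Nat.Divisibility using (_∣_; _∣?_)
open import Data.Fin using (Fin; toℕ)
import Data.Fin as F
open import Data.Product using (Σ; ∃; _×_; _,_)
open import Relation.Nullary using (¬_; yes; no)
open import Relation.Binary.PropositionalEquality using (_≡_)

∑ : (n : ℕ) → (Fin n → ℕ) → ℕ
∑ zero    f = 0
∑ (suc n) f = f F.zero + ∑ n (λ i → f (F.suc i))

σ : ℕ → ℕ → ℕ
σ p k = ∑ (suc k) (λ j → p ^ toℕ j)

-- An m × n matrix over 𝔽_p, with 𝔽_p = Fin p (residues 0..p-1).
Matrix : ℕ → ℕ → ℕ → Set
Matrix p m n = Fin m → Fin n → Fin p

count : (n : ℕ) → (P : Fin n → Set) → (∀ j → Relation.Nullary.Dec (P j)) → ℕ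
count zero    P d = 0
count (suc n) P d with d F.zero
... | yes _ = suc (count n (λ j → P (F.suc j)) (λ j → d (F.suc j)))
... | no  _ = count n (λ j → P (F.suc j)) (λ j → d (F.suc j))

-- The row combination ∑_i a_i M_i, j-th coordinate, as a natural number
-- representative (its class mod p is the 𝔽_p entry).
combℕ : ∀ {p m n} → (Fin m → Fin p) → Matrix p m n → Fin n → ℕ
combℕ {m = m} a M j = ∑ m (λ i → toℕ (a i) * toℕ (M i j))

weight : ∀ {p m n} → (Fin m → Fin p) → Matrix p m n → ℕ
weight {p} {n = n} a M = count n (λ j → ¬ (p ∣ combℕ a M j)) (λ j → Relation.Nullary.¬? (p ∣? combℕ a M j))

-- Every vector of row(M) is ∑_i a_i M_i for some a ∈ 𝔽_p^m.
-- c(M) = c : it is attained, and it bounds every row-space vector.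
IsCapacity : ∀ {p m n} → Matrix p m n → ℕ → Set
IsCapacity {p} {m} M c =
  (Σ (Fin m → Fin p) λ a → weight a M ≡ c) × (∀ (a : Fin m → Fin p) → weight a M ≤ c)

NoZeroColumn : ∀ {p m n} → Matrix p m n → Set
NoZeroColumn {m = m} {n} M = ∀ (j : Fin n) → Σ (Fin m) λ i → ¬ (toℕ (M i j) ≡ 0)

InMstar : (p n m : ℕ) → Matrix p m n → Set
InMstar p n m M = 1 ≤ m × m ≤ p ^ n × NoZeroColumn M

IsLambda : (p n L : ℕ) → Set
IsLambda p n L =
  (Σ ℕ λ m → Σ (Matrix p m n) λ M → InMstar p n m M × IsCapacity M L)
  × (∀ (m : ℕ) (M : Matrix p m n) (c : ℕ) → InMstar p n m M → IsCapacity M c → L ≤ c)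

IsRep : (p n k : ℕ) → (Fin (suc k) → ℕ) → Set
IsRep p n k b =
  (∀ j → b j ≤ p)
  × (∀ j → b j ≡ p → ∀ i → toℕ i < toℕ j → b i ≡ 0)
  × n ≡ ∑ (suc k) (λ j → b j * σ p (toℕ j))

module Submission where

-- Let G(w) = Σ_{i ≥ 0} ⌊w / pⁱ⌋ (floorSum).  A row-space vector of M is a · M for a ∈ 𝔽ₚᵐ, and its
-- weight counts the columns c with a · c ≠ 0.
--
-- Lower bound: n nonzero columns and capacity c force n ≤ G(c).  Take h of maximal weight t.
-- Averaging over the p vectors a + x h shows that every a has weight at most ⌊t / p⌋ on the
-- n − t columns orthogonal to h, so by induction n − t ≤ G(⌊t / p⌋), i.e. n ≤ G(t) ≤ G(c).
--
-- Upper bound: take b_j copies of the points of PG(j, p) as columns, n = Σ b_j σ_j of them.  Any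
-- a has a · c ≠ 0 for at most p^j points c of PG(j, p), so the capacity is at most F = Σ b_j p^j.
--
-- Arithmetic: with N = Σ b_j σ_j one has N(b) = b₀ + p F(b′) + N(b′) for the shifted digits b′,
-- and G(c + p w) = c + p w + G(w) for c < p.  Hence G(F) = N when all digits are below p, and
-- G(F − 1) < N for every admissible b, so F is the least c with n ≤ G(c).  Admissible
-- representations exist by the greedy algorithm for the σ_j.

open import Defs
open import Data.Bool using (true; false; if_then_else_)
open import Data.Fin as F using (Fin; toℕ; punchOut)
open import Data.Fin.Properties using (toℕ<n; toℕ-injective; toℕ-fromℕ<; cast-is-id; punchOut-injective; <⇒notInjective; any?)
import Data.Fin.Properties as Finₚ
open import Data.List as L using (List; []; _∷_; length; _++_)
open import Data.List.Properties using (length-++; length-tabulate; tabulate-cong; tabulate-lookup)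
open import Data.List.Relation.Unary.All as All using (All; []; _∷_)
import Data.List.Relation.Unary.All.Properties as Allₚ
open import Data.Nat using (ℕ; zero; suc; _+_; _*_; _^_; _∸_; _≤_; _<_; z≤n; s≤s; s≤s⁻¹; NonZero; >-nonZero; >-nonZero⁻¹; _≤?_; _≟_)
open import Data.Nat.DivMod
open import Data.Nat.Divisibility using (_∣_; _∣?_; m∣m*n; n∣m*n; ∣m⇒∣m*n; ∣n⇒∣m*n; ∣m+n∣m⇒∣n; >⇒∤; m%n≡0⇒n∣m; n∣m⇒m%n≡0)
open import Data.Nat.Primality using (Prime; euclidsLemma; ¬prime[0]; ¬prime[1])
open import Data.Nat.Properties
open import Algebra.Properties.CommutativeSemigroup +-commutativeSemigroup using (interchange)
open import Data.Nat.Tactic.RingSolver using (solve-∀)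
open import Data.Product using (Σ; ∃; _×_; _,_; proj₁; proj₂)
open import Data.Sum using (inj₁; inj₂)
open import Data.Vec.Functional using (tail) renaming (_∷_ to _◂_)
open import Function using (_∘_)
open import Relation.Binary.PropositionalEquality
open import Relation.Nullary using (¬_; yes; no; does; contradiction; ¬?)
open import Relation.Nullary.Decidable using (dec-true; dec-false)

∑-cong : ∀ n {f g : Fin n → ℕ} → (∀ i → f i ≡ g i) → ∑ n f ≡ ∑ n g
∑-cong zero    f≡g = refl
∑-cong (suc n) f≡g = cong₂ _+_ (f≡g F.zero) (∑-cong n (f≡g ∘ F.suc))

∑-distrib-+ : ∀ n (f g : Fin n → ℕ) → ∑ n (λ i → f i + g i) ≡ ∑ n f + ∑ n g
∑-distrib-+ zero    f g = refl
∑-distrib-+ (suc n) f g = begin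
  f F.zero + g F.zero + ∑ n (λ i → f (F.suc i) + g (F.suc i))
    ≡⟨ cong (f F.zero + g F.zero +_) (∑-distrib-+ n (tail f) (tail g)) ⟩
  f F.zero + g F.zero + (∑ n (tail f) + ∑ n (tail g))
    ≡⟨ interchange (f F.zero) (g F.zero) (∑ n (tail f)) (∑ n (tail g)) ⟩
  f F.zero + ∑ n (tail f) + (g F.zero + ∑ n (tail g)) ∎
  where open ≡-Reasoning

∑-distribˡ-* : ∀ n c (f : Fin n → ℕ) → ∑ n (λ i → c * f i) ≡ c * ∑ n f
∑-distribˡ-* zero    c f = sym (*-zeroʳ c)
∑-distribˡ-* (suc n) c f =
  trans (cong (c * f F.zero +_) (∑-distribˡ-* n c (tail f)))
        (sym (*-distribˡ-+ c (f F.zero) _))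

∑-distribʳ-* : ∀ n c (f : Fin n → ℕ) → ∑ n (λ i → f i * c) ≡ ∑ n f * c
∑-distribʳ-* n c f =
  trans (∑-cong n (λ i → *-comm (f i) c)) (trans (∑-distribˡ-* n c f) (*-comm c (∑ n f)))

∑-mono-≤ : ∀ n {f g : Fin n → ℕ} → (∀ i → f i ≤ g i) → ∑ n f ≤ ∑ n g
∑-mono-≤ zero    f≤g = z≤n
∑-mono-≤ (suc n) f≤g = +-mono-≤ (f≤g F.zero) (∑-mono-≤ n (f≤g ∘ F.suc))

∑-const : ∀ n c → ∑ n (λ _ → c) ≡ n * c
∑-const zero    c = refl
∑-const (suc n) c = cong (c +_) (∑-const n c)

∑-≤-const : ∀ n c {f : Fin n → ℕ} → (∀ i → f i ≤ c) → ∑ n f ≤ n * c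
∑-≤-const n c f≤c = ≤-trans (∑-mono-≤ n f≤c) (≤-reflexive (∑-const n c))

term≤∑ : ∀ n (f : Fin n → ℕ) i → f i ≤ ∑ n f
term≤∑ (suc n) f F.zero    = m≤m+n _ _
term≤∑ (suc n) f (F.suc i) = ≤-trans (term≤∑ n (tail f) i) (m≤n+m _ _)

maximizer-Fin : ∀ q (g : Fin (suc q) → ℕ) → ∃ λ i → ∀ j → g j ≤ g i
maximizer-Fin zero    g = F.zero , λ { F.zero → ≤-refl }
maximizer-Fin (suc q) g with maximizer-Fin q (tail g)
... | i , gᵢ-max with g F.zero ≤? g (F.suc i)
...   | yes g₀≤gᵢ = F.suc i , λ { F.zero → g₀≤gᵢ ; (F.suc j) → gᵢ-max j }
...   | no  g₀≰gᵢ = F.zero , λ { F.zero → ≤-refl ; (F.suc j) → ≤-trans (gᵢ-max j) (<⇒≤ (≰⇒> g₀≰gᵢ)) }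

∑≤-if-≤1-with-zero : ∀ n (f : Fin (suc n) → ℕ) → (∀ i → f i ≤ 1) → ∀ i → f i ≡ 0 → ∑ (suc n) f ≤ n
∑≤-if-≤1-with-zero n       f f≤1 F.zero    f₀≡0 rewrite f₀≡0 =
  subst (∑ n (tail f) ≤_) (*-identityʳ n) (∑-≤-const n 1 (f≤1 ∘ F.suc))
∑≤-if-≤1-with-zero (suc n) f f≤1 (F.suc i) fᵢ≡0 =
  +-mono-≤ (f≤1 F.zero) (∑≤-if-≤1-with-zero n (tail f) (f≤1 ∘ F.suc) i fᵢ≡0)

≤suc∑-if-unique-zero : ∀ q (f : Fin q → ℕ) → (∀ i j → f i ≡ 0 → f j ≡ 0 → i ≡ j) → q ≤ suc (∑ q f)
≤suc∑-if-unique-zero zero    f unique = z≤n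
≤suc∑-if-unique-zero (suc q) f unique with f F.zero in f₀≡
... | suc y = s≤s (≤-trans (≤suc∑-if-unique-zero q (tail f) (λ i j fi≡0 fj≡0 → Finₚ.suc-injective (unique _ _ fi≡0 fj≡0)))
                           (s≤s (m≤n+m _ y)))
... | zero  = s≤s (begin
  q                    ≡⟨ *-identityʳ q ⟨
  q * 1                ≡⟨ ∑-const q 1 ⟨
  ∑ q (λ _ → 1)        ≤⟨ ∑-mono-≤ q tail≥1 ⟩
  ∑ q (tail f)         ∎)
  where
  open ≤-Reasoning
  tail≥1 : ∀ i → 1 ≤ tail f i
  tail≥1 i = n≢0⇒n>0 λ fi≡0 → 0≢1+n (cong toℕ (unique F.zero (F.suc i) f₀≡ fi≡0))

∑-cong-% : ∀ n {d} .{{_ : NonZero d}} {f g : Fin n → ℕ} → (∀ i → f i % d ≡ g i % d) →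
           ∑ n f % d ≡ ∑ n g % d
∑-cong-% zero    f≡g = refl
∑-cong-% (suc n) {d} {f} {g} f≡g = begin
  (f F.zero + ∑ n (tail f)) % d               ≡⟨ %-distribˡ-+ (f F.zero) _ d ⟩
  (f F.zero % d + ∑ n (tail f) % d) % d       ≡⟨ cong₂ (λ x y → (x + y) % d) (f≡g F.zero) (∑-cong-% n (f≡g ∘ F.suc)) ⟩
  (g F.zero % d + ∑ n (tail g) % d) % d       ≡⟨ %-distribˡ-+ (g F.zero) _ d ⟨
  (g F.zero + ∑ n (tail g)) % d               ∎
  where open ≡-Reasoning

∑-toℕ-last : ∀ n (f : ℕ → ℕ) → ∑ (suc n) (f ∘ toℕ) ≡ ∑ n (f ∘ toℕ) + f n
∑-toℕ-last zero    f = +-identityʳ (f 0)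
∑-toℕ-last (suc n) f =
  trans (cong (f 0 +_) (∑-toℕ-last n (f ∘ suc))) (sym (+-assoc (f 0) _ _))

quotient≤ : ∀ {n d} .{{_ : NonZero d}} q → n ≤ q * d → n / d ≤ q
quotient≤ {n} {d} q n≤qd = ≤-trans (/-monoˡ-≤ d n≤qd) (≤-reflexive (m*n/n≡m q d))

quotient≡⇒remainder≡0 : ∀ {n d} .{{_ : NonZero d}} q → n ≤ q * d → n / d ≡ q → n % d ≡ 0
quotient≡⇒remainder≡0 {n} {d} q n≤qd n/d≡q = n≤0⇒n≡0 (+-cancelʳ-≤ (q * d) (n % d) 0 (begin
  n % d + q * d         ≡⟨ cong (λ x → n % d + x * d) n/d≡q ⟨
  n % d + n / d * d     ≡⟨ m≡m%n+[m/n]*n n d ⟨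
  n                     ≤⟨ n≤qd ⟩
  q * d                 ∎))
  where open ≤-Reasoning

∣-<⇒≡0 : ∀ {d n} → n < d → d ∣ n → n ≡ 0
∣-<⇒≡0 {n = zero}  _   _   = refl
∣-<⇒≡0 {n = suc n} n<d d∣n = contradiction d∣n (>⇒∤ n<d)

%≡%-+⇒∣ : ∀ {d} .{{_ : NonZero d}} u v → u % d ≡ (u + v) % d → d ∣ v
%≡%-+⇒∣ {d} u v eq = ∣m+n∣m⇒∣n (subst (d ∣_) (sym (+-cancelˡ-≡ (u % d) _ _ shifted)) (n∣m*n ((u + v) / d)))
                               (n∣m*n (u / d))
  where
  open ≡-Reasoning
  shifted : u % d + (u / d * d + v) ≡ u % d + (u + v) / d * d
  shifted = begin
    u % d + (u / d * d + v)          ≡⟨ +-assoc (u % d) _ v ⟨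
    u % d + u / d * d + v            ≡⟨ cong (_+ v) (m≡m%n+[m/n]*n u d) ⟨
    u + v                            ≡⟨ m≡m%n+[m/n]*n (u + v) d ⟩
    (u + v) % d + (u + v) / d * d    ≡⟨ cong (_+ (u + v) / d * d) eq ⟨
    u % d + (u + v) / d * d          ∎

[m%d*n]%d≡[m*n]%d : ∀ m n {d} .{{_ : NonZero d}} → (m % d * n) % d ≡ (m * n) % d
[m%d*n]%d≡[m*n]%d m n {d} = begin
  (m % d * n) % d                ≡⟨ %-distribˡ-* (m % d) n d ⟩
  (m % d % d * (n % d)) % d      ≡⟨ cong (λ x → (x * (n % d)) % d) (m%n%n≡m%n m d) ⟩
  (m % d * (n % d)) % d          ≡⟨ %-distribˡ-* m n d ⟨
  (m * n) % d                    ∎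
  where open ≡-Reasoning

copies : ∀ {A : Set} → ℕ → List A → List A
copies zero    xs = []
copies (suc c) xs = xs ++ copies c xs

length-copies : ∀ {A : Set} c (xs : List A) → length (copies c xs) ≡ c * length xs
length-copies zero    xs = refl
length-copies (suc c) xs = trans (length-++ xs) (cong (length xs +_) (length-copies c xs))

All-copies : ∀ {A : Set} {P : A → Set} c {xs} → (1 ≤ c → All P xs) → All P (copies c xs)
All-copies zero    _      = []
All-copies (suc c) All-Pxs = Allₚ.++⁺ Pxs (All-copies c (λ _ → Pxs))
  where Pxs = All-Pxs (s≤s z≤n)

tabulate-lookup-cast : ∀ {A : Set} (xs : List A) {n} (eq : length xs ≡ n) →
                       L.tabulate (L.lookup xs ∘ F.cast (sym eq)) ≡ xs
tabulate-lookup-cast xs refl =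
  trans (tabulate-cong (λ j → cong (L.lookup xs) (cast-is-id refl j))) (tabulate-lookup xs)

-- The modulus is written p = 2 + r, so that p is visibly nonzero and Fin p has constructors for 0 and 1.
module Radix (r : ℕ) where

  p : ℕ
  p = 2 + r

  instance
    p-nonZero : NonZero p
    p-nonZero = _

  1<p : 1 < p
  1<p = s≤s (s≤s z≤n)

  σ-sucʳ : ∀ j → σ p (suc j) ≡ σ p j + p ^ suc j
  σ-sucʳ j = ∑-toℕ-last (suc j) (p ^_)

  σ-sucˡ : ∀ j → σ p (suc j) ≡ 1 + p * σ p j
  σ-sucˡ j = cong suc (∑-distribˡ-* (suc j) p (λ i → p ^ toℕ i))

  σ>index : ∀ j → j < σ p j
  σ>index zero    = s≤s z≤n
  σ>index (suc j) = begin-strict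
    suc j                  ≤⟨ σ>index j ⟩
    σ p j                  <⟨ m<m+n (σ p j) (m^n>0 p (suc j)) ⟩
    σ p j + p ^ suc j      ≡⟨ σ-sucʳ j ⟨
    σ p (suc j)            ∎
    where open ≤-Reasoning

  -- floorSum w = Σ_{i ≥ 0} ⌊w / pⁱ⌋; the fuel w suffices because ⌊w / p⌋ < w for w > 0.
  floorSumᶠ : ℕ → ℕ → ℕ
  floorSumᶠ zero     w = 0
  floorSumᶠ (suc fuel) w = w + floorSumᶠ fuel (w / p)

  floorSum : ℕ → ℕ
  floorSum w = floorSumᶠ w w

  floorSumᶠ-0 : ∀ fuel → floorSumᶠ fuel 0 ≡ 0
  floorSumᶠ-0 zero       = refl
  floorSumᶠ-0 (suc fuel) = floorSumᶠ-0 fuel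

  /p<suc : ∀ w → suc w / p ≤ w
  /p<suc w = s≤s⁻¹ (m/n<m (suc w) p 1<p)

  floorSumᶠ-fuel : ∀ f₁ f₂ w → w ≤ f₁ → w ≤ f₂ → floorSumᶠ f₁ w ≡ floorSumᶠ f₂ w
  floorSumᶠ-fuel f₁ f₂ zero _ _ = trans (floorSumᶠ-0 f₁) (sym (floorSumᶠ-0 f₂))
  floorSumᶠ-fuel (suc f₁) (suc f₂) (suc w) (s≤s w≤f₁) (s≤s w≤f₂) =
    cong (suc w +_) (floorSumᶠ-fuel f₁ f₂ (suc w / p)
      (≤-trans (/p<suc w) w≤f₁) (≤-trans (/p<suc w) w≤f₂))

  floorSum-unfold : ∀ w → floorSum w ≡ w + floorSum (w / p)
  floorSum-unfold zero    = refl
  floorSum-unfold (suc w) =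
    cong (suc w +_) (floorSumᶠ-fuel w (suc w / p) (suc w / p) (/p<suc w) ≤-refl)

  floorSumᶠ-mono : ∀ fuel {v w} → v ≤ w → floorSumᶠ fuel v ≤ floorSumᶠ fuel w
  floorSumᶠ-mono zero       _   = z≤n
  floorSumᶠ-mono (suc fuel) v≤w = +-mono-≤ v≤w (floorSumᶠ-mono fuel (/-monoˡ-≤ p v≤w))

  floorSum-mono : ∀ {v w} → v ≤ w → floorSum v ≤ floorSum w
  floorSum-mono {v} {w} v≤w =
    subst (_≤ floorSum w) (floorSumᶠ-fuel w v v v≤w ≤-refl) (floorSumᶠ-mono w v≤w)

  floorSum-digit : ∀ c w → c < p → floorSum (c + p * w) ≡ c + p * w + floorSum w
  floorSum-digit c w c<p = begin
    floorSum (c + p * w)                       ≡⟨ floorSum-unfold (c + p * w) ⟩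
    c + p * w + floorSum ((c + p * w) / p)     ≡⟨ cong (λ x → c + p * w + floorSum x) quotient ⟩
    c + p * w + floorSum w                     ∎
    where
    open ≡-Reasoning
    quotient : (c + p * w) / p ≡ w
    quotient = begin
      (c + p * w) / p     ≡⟨ +-distrib-/-∣ʳ c (m∣m*n w) ⟩
      c / p + p * w / p   ≡⟨ cong₂ _+_ (m<n⇒m/n≡0 c<p) (trans (cong (_/ p) (*-comm p w)) (m*n/n≡m w p)) ⟩
      w                   ∎

  floorSum-p*-pred : ∀ w → floorSum (p * w ∸ 1) ≤ p * w + floorSum (w ∸ 1)
  floorSum-p*-pred zero    rewrite *-zeroʳ p = z≤n
  floorSum-p*-pred (suc w) = begin
    floorSum (p * suc w ∸ 1)              ≡⟨ cong floorSum (p*suc∸1 w) ⟩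
    floorSum (suc r + p * w)              ≡⟨ floorSum-digit (suc r) w ≤-refl ⟩
    suc r + p * w + floorSum w            ≡⟨ cong (_+ floorSum w) (p*suc∸1 w) ⟨
    p * suc w ∸ 1 + floorSum w            ≤⟨ +-monoˡ-≤ (floorSum w) (m∸n≤m (p * suc w) 1) ⟩
    p * suc w + floorSum w                ∎
    where
    open ≤-Reasoning
    p*suc∸1 : ∀ w → p * suc w ∸ 1 ≡ suc r + p * w
    p*suc∸1 w = cong (_∸ 1) (expand r w)
      where
      expand : ∀ r w → (2 + r) * suc w ≡ 1 + (suc r + (2 + r) * w)
      expand = solve-∀

  σ-expansion : ∀ K → (Fin K → ℕ) → ℕ
  σ-expansion K b = ∑ K (λ j → b j * σ p (toℕ j))

  p-expansion : ∀ K → (Fin K → ℕ) → ℕ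
  p-expansion K b = ∑ K (λ j → b j * p ^ toℕ j)

  p-expansion-suc : ∀ K b → p-expansion (suc K) b ≡ b F.zero + p * p-expansion K (tail b)
  p-expansion-suc K b = cong₂ _+_ (*-identityʳ (b F.zero)) (begin
    ∑ K (λ j → tail b j * (p * p ^ toℕ j))   ≡⟨ ∑-cong K (λ j → x*[p*y]≡p*[x*y] (tail b j) p (p ^ toℕ j)) ⟩
    ∑ K (λ j → p * (tail b j * p ^ toℕ j))   ≡⟨ ∑-distribˡ-* K p _ ⟩
    p * p-expansion K (tail b)               ∎)
    where
    open ≡-Reasoning
    x*[p*y]≡p*[x*y] : ∀ x p y → x * (p * y) ≡ p * (x * y)
    x*[p*y]≡p*[x*y] = solve-∀

  σ-expansion-suc : ∀ K b →
    σ-expansion (suc K) b ≡ b F.zero + p * p-expansion K (tail b) + σ-expansion K (tail b)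
  σ-expansion-suc K b = begin
    b F.zero * 1 + ∑ K (λ j → tail b j * σ p (suc (toℕ j)))
      ≡⟨ cong₂ _+_ (*-identityʳ (b F.zero)) (∑-cong K (λ j → split (tail b j) (toℕ j))) ⟩
    b F.zero + ∑ K (λ j → p * (tail b j * p ^ toℕ j) + tail b j * σ p (toℕ j))
      ≡⟨ cong (b F.zero +_) (∑-distrib-+ K _ _) ⟩
    b F.zero + (∑ K (λ j → p * (tail b j * p ^ toℕ j)) + σ-expansion K (tail b))
      ≡⟨ cong (λ x → b F.zero + (x + σ-expansion K (tail b))) (∑-distribˡ-* K p _) ⟩
    b F.zero + (p * p-expansion K (tail b) + σ-expansion K (tail b))
      ≡⟨ +-assoc (b F.zero) _ _ ⟨
    b F.zero + p * p-expansion K (tail b) + σ-expansion K (tail b) ∎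
    where
    open ≡-Reasoning
    distrib : ∀ x s p q → x * (s + p * q) ≡ p * (x * q) + x * s
    distrib = solve-∀
    split : ∀ x j → x * σ p (suc j) ≡ p * (x * p ^ j) + x * σ p j
    split x j = trans (cong (x *_) (σ-sucʳ j)) (distrib x (σ p j) p (p ^ j))

  Admissible : ∀ K → (Fin K → ℕ) → Set
  Admissible K b = (∀ j → b j ≤ p) × (∀ j → b j ≡ p → ∀ i → toℕ i < toℕ j → b i ≡ 0)

  admissible-tail : ∀ {K} {b : Fin (suc K) → ℕ} → Admissible (suc K) b → Admissible K (tail b)
  admissible-tail (b≤p , below) =
    b≤p ∘ F.suc , λ j bⱼ≡p i i<j → below (F.suc j) bⱼ≡p (F.suc i) (s≤s i<j)

  admissible-tail<p : ∀ {K} {b : Fin (suc K) → ℕ} → Admissible (suc K) b → b F.zero ≢ 0 →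
                      ∀ j → tail b j < p
  admissible-tail<p (b≤p , below) b₀≢0 j =
    ≤∧≢⇒< (b≤p (F.suc j)) (λ bⱼ≡p → b₀≢0 (below (F.suc j) bⱼ≡p F.zero (s≤s z≤n)))

  floorSum-p-expansion : ∀ K b → (∀ j → b j < p) → floorSum (p-expansion K b) ≡ σ-expansion K b
  floorSum-p-expansion zero    b b<p = refl
  floorSum-p-expansion (suc K) b b<p = begin
    floorSum (p-expansion (suc K) b)       ≡⟨ cong floorSum (p-expansion-suc K b) ⟩
    floorSum (b F.zero + p * F′)           ≡⟨ floorSum-digit (b F.zero) F′ (b<p F.zero) ⟩
    b F.zero + p * F′ + floorSum F′        ≡⟨ cong (b F.zero + p * F′ +_) (floorSum-p-expansion K (tail b) (b<p ∘ F.suc)) ⟩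
    b F.zero + p * F′ + σ-expansion K (tail b) ≡⟨ σ-expansion-suc K b ⟨
    σ-expansion (suc K) b                  ∎
    where
    open ≡-Reasoning
    F′ = p-expansion K (tail b)

  floorSum-pred-p-expansion< : ∀ K b → Admissible K b → 1 ≤ p-expansion K b →
                               floorSum (p-expansion K b ∸ 1) < σ-expansion K b
  floorSum-pred-p-expansion< (suc K) b adm F≥1
    rewrite p-expansion-suc K b | σ-expansion-suc K b with b F.zero in b₀≡
  ... | suc c = begin-strict
    floorSum (c + p * F′)          ≡⟨ floorSum-digit c F′ (subst (_≤ p) b₀≡ (proj₁ adm F.zero)) ⟩
    c + p * F′ + floorSum F′       ≡⟨ cong (c + p * F′ +_) (floorSum-p-expansion K (tail b) tail<p) ⟩
    c + p * F′ + N′                <⟨ n<1+n _ ⟩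
    suc c + p * F′ + N′            ∎
    where
    open ≤-Reasoning
    F′ = p-expansion K (tail b)
    N′ = σ-expansion K (tail b)
    tail<p : ∀ j → tail b j < p
    tail<p = admissible-tail<p adm (λ b₀≡0 → 0≢1+n (trans (sym b₀≡0) b₀≡))
  ... | zero = begin-strict
    floorSum (p * F′ ∸ 1)          ≤⟨ floorSum-p*-pred F′ ⟩
    p * F′ + floorSum (F′ ∸ 1)     <⟨ +-monoʳ-< (p * F′) (floorSum-pred-p-expansion< K (tail b) (admissible-tail adm) F′≥1) ⟩
    p * F′ + N′                    ∎
    where
    open ≤-Reasoning
    F′ = p-expansion K (tail b)
    N′ = σ-expansion K (tail b)
    F′≥1 : 1 ≤ F′
    F′≥1 = >-nonZero⁻¹ F′ {{m*n≢0⇒n≢0 p {{>-nonZero F≥1}}}}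

  p-expansion-least : ∀ K b c → Admissible K b → σ-expansion K b ≤ floorSum c → p-expansion K b ≤ c
  p-expansion-least K b c adm N≤floorSum-c = ≮⇒≥ λ c<F → <-irrefl refl (begin-strict
    floorSum c                         ≤⟨ floorSum-mono (∸-monoˡ-≤ 1 c<F) ⟩
    floorSum (p-expansion K b ∸ 1)     <⟨ floorSum-pred-p-expansion< K b adm (≤-trans (s≤s z≤n) c<F) ⟩
    σ-expansion K b                    ≤⟨ N≤floorSum-c ⟩
    floorSum c                         ∎)
    where open ≤-Reasoning

  <σ-suc⇒≤p*σ : ∀ {n} k → n < σ p (suc k) → n ≤ p * σ p k
  <σ-suc⇒≤p*σ {n} k n< = s≤s⁻¹ (subst (n <_) (σ-sucˡ k) n<)

  greedy : ℕ → ℕ → ℕ → ℕ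
  greedy zero    n j = n
  greedy (suc k) n j with j ≤? k
  ... | yes _ = greedy k (n % σ p (suc k)) j
  ... | no  _ = n / σ p (suc k)

  greedy-below : ∀ k n {j} → j ≤ k → greedy (suc k) n j ≡ greedy k (n % σ p (suc k)) j
  greedy-below k n {j} j≤k with j ≤? k
  ... | yes _   = refl
  ... | no  j≰k = contradiction j≤k j≰k

  greedy-top : ∀ k n → greedy (suc k) n (suc k) ≡ n / σ p (suc k)
  greedy-top k n with suc k ≤? k
  ... | yes k<k = contradiction k<k (n≮n k)
  ... | no  _   = refl

  greedy-zero : ∀ k j → greedy k 0 j ≡ 0
  greedy-zero zero    j = refl
  greedy-zero (suc k) j with j ≤? k
  ... | yes _ = greedy-zero k j
  ... | no  _ = 0/n≡0 (σ p (suc k))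

  greedy-≤p : ∀ k {n} → n < σ p (suc k) → ∀ j → j ≤ k → greedy k n j ≤ p
  greedy-≤p zero {n} n< j _ = subst (n ≤_) (*-identityʳ p) (<σ-suc⇒≤p*σ 0 n<)
  greedy-≤p (suc k) {n} n< j _ with j ≤? k
  ... | yes j≤k = greedy-≤p k (m%n<n n (σ p (suc k))) j j≤k
  ... | no  _   = quotient≤ p (<σ-suc⇒≤p*σ (suc k) n<)

  -- A top digit p forces n = p σₖ, so the remainder and hence all lower digits vanish.
  greedy-≡p⇒below≡0 : ∀ k {n} → n < σ p (suc k) → ∀ j → j ≤ k → greedy k n j ≡ p →
                      ∀ i → i < j → greedy k n i ≡ 0
  greedy-≡p⇒below≡0 zero    _  _ z≤n _ _ ()
  greedy-≡p⇒below≡0 (suc k) {n} n< j j≤ digit≡p i i<j with j ≤? k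
  ... | yes j≤k = trans (greedy-below k n (<⇒≤ (<-≤-trans i<j j≤k)))
                    (greedy-≡p⇒below≡0 k (m%n<n n S) j j≤k digit≡p i i<j)
    where S = σ p (suc k)
  ... | no  _   = begin
    greedy (suc k) n i       ≡⟨ greedy-below k n (s≤s⁻¹ (<-≤-trans i<j j≤)) ⟩
    greedy k (n % S) i       ≡⟨ cong (λ x → greedy k x i) (quotient≡⇒remainder≡0 p (<σ-suc⇒≤p*σ (suc k) n<) digit≡p) ⟩
    greedy k 0 i             ≡⟨ greedy-zero k i ⟩
    0                        ∎
    where
    open ≡-Reasoning
    S = σ p (suc k)

  greedy-sum : ∀ k {n} → n < σ p (suc k) → n ≡ ∑ (suc k) (λ j → greedy k n (toℕ j) * σ p (toℕ j))
  greedy-sum zero    {n} _  = sym (trans (+-identityʳ _) (*-identityʳ n))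
  greedy-sum (suc k) {n} n< = sym (begin
    ∑ (suc (suc k)) (digitValue ∘ toℕ)           ≡⟨ ∑-toℕ-last (suc k) digitValue ⟩
    ∑ (suc k) (digitValue ∘ toℕ) + digitValue (suc k)
                                                 ≡⟨ cong₂ _+_ lower (cong (_* S) (greedy-top k n)) ⟩
    n % S + n / S * S                            ≡⟨ m≡m%n+[m/n]*n n S ⟨
    n                                            ∎)
    where
    open ≡-Reasoning
    S = σ p (suc k)
    digitValue : ℕ → ℕ
    digitValue j = greedy (suc k) n j * σ p j
    lower : ∑ (suc k) (digitValue ∘ toℕ) ≡ n % S
    lower = trans (∑-cong (suc k) λ j → cong (_* σ p (toℕ j)) (greedy-below k n (s≤s⁻¹ (toℕ<n j))))
                  (sym (greedy-sum k (m%n<n n S)))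

  representation-exists : ∀ k n → n < σ p (suc k) → Σ (Fin (suc k) → ℕ) (IsRep p n k)
  representation-exists k n n< =
    (λ j → greedy k n (toℕ j)) ,
    (λ j → greedy-≤p k n< (toℕ j) (index≤k j)) ,
    (λ j digit≡p i → greedy-≡p⇒below≡0 k n< (toℕ j) (index≤k j) digit≡p (toℕ i)) ,
    greedy-sum k n<
    where
    index≤k : (j : Fin (suc k)) → toℕ j ≤ k
    index≤k j = s≤s⁻¹ (toℕ<n j)

module PrimeField (r : ℕ) (p-prime : Prime (2 + r)) where

  open Radix r

  private
    scaled-injective-≤ : ∀ A {B} → ¬ p ∣ B → ∀ {x₁ x₂ : Fin p} → toℕ x₁ ≤ toℕ x₂ →
                         (A + toℕ x₁ * B) % p ≡ (A + toℕ x₂ * B) % p → toℕ x₁ ≡ toℕ x₂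
    scaled-injective-≤ A {B} p∤B {x₁} {x₂} x₁≤x₂ eq = begin
      toℕ x₁              ≡⟨ +-identityʳ (toℕ x₁) ⟨
      toℕ x₁ + 0          ≡⟨ cong (toℕ x₁ +_) d≡0 ⟨
      toℕ x₁ + d          ≡⟨ m+[n∸m]≡n x₁≤x₂ ⟩
      toℕ x₂              ∎
      where
      open ≡-Reasoning
      d = toℕ x₂ ∸ toℕ x₁
      split : A + toℕ x₂ * B ≡ (A + toℕ x₁ * B) + d * B
      split = begin
        A + toℕ x₂ * B              ≡⟨ cong (λ x → A + x * B) (m+[n∸m]≡n x₁≤x₂) ⟨
        A + (toℕ x₁ + d) * B        ≡⟨ cong (A +_) (*-distribʳ-+ B (toℕ x₁) d) ⟩
        A + (toℕ x₁ * B + d * B)    ≡⟨ +-assoc A _ _ ⟨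
        A + toℕ x₁ * B + d * B      ∎
      d≡0 : d ≡ 0
      d≡0 with euclidsLemma d B p-prime (%≡%-+⇒∣ (A + toℕ x₁ * B) (d * B) (trans eq (cong (_% p) split)))
      ... | inj₁ p∣d = ∣-<⇒≡0 (≤-<-trans (m∸n≤m (toℕ x₂) (toℕ x₁)) (toℕ<n x₂)) p∣d
      ... | inj₂ p∣B = contradiction p∣B p∤B

  scaled-injective : ∀ A {B} → ¬ p ∣ B → ∀ x₁ x₂ →
                     (A + toℕ x₁ * B) % p ≡ (A + toℕ x₂ * B) % p → x₁ ≡ x₂
  scaled-injective A p∤B x₁ x₂ eq with ≤-total (toℕ x₁) (toℕ x₂)
  ... | inj₁ x₁≤x₂ = toℕ-injective (scaled-injective-≤ A p∤B x₁≤x₂ eq)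
  ... | inj₂ x₂≤x₁ = sym (toℕ-injective (scaled-injective-≤ A p∤B x₂≤x₁ (sym eq)))

  -- If no x made A + x B vanish mod p, x ↦ (A + x B) mod p would inject 𝔽ₚ into 𝔽ₚ ∖ {0}.
  exists-root : ∀ {B} → ¬ p ∣ B → ∀ A → ∃ λ (x : Fin p) → p ∣ A + toℕ x * B
  exists-root {B} p∤B A with any? (λ x → p ∣? (A + toℕ x * B))
  ... | yes root  = root
  ... | no  ¬root = contradiction (λ {x₁} {x₂} → punchOut-residue-injective {x₁} {x₂}) (<⇒notInjective ≤-refl)
    where
    residue : Fin p → Fin p
    residue x = (A + toℕ x * B) mod p
    residue≢0 : ∀ x → F.zero ≢ residue x
    residue≢0 x 0≡residue =
      ¬root (x , m%n≡0⇒n∣m _ p (trans (sym (toℕ-fromℕ< (m%n<n (A + toℕ x * B) p))) (cong toℕ (sym 0≡residue))))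
    punchOut-residue-injective : ∀ {x₁ x₂} → punchOut (residue≢0 x₁) ≡ punchOut (residue≢0 x₂) → x₁ ≡ x₂
    punchOut-residue-injective {x₁} {x₂} eq = scaled-injective A p∤B x₁ x₂ (begin
      (A + toℕ x₁ * B) % p   ≡⟨ toℕ-fromℕ< (m%n<n (A + toℕ x₁ * B) p) ⟨
      toℕ (residue x₁)       ≡⟨ cong toℕ (punchOut-injective (residue≢0 x₁) (residue≢0 x₂) eq) ⟩
      toℕ (residue x₂)       ≡⟨ toℕ-fromℕ< (m%n<n (A + toℕ x₂ * B) p) ⟩
      (A + toℕ x₂ * B) % p   ∎)
      where open ≡-Reasoning

  𝔽^_ : ℕ → Set
  𝔽^ m = Fin m → Fin p

  infix 7 _·_
  _·_ : ∀ {m} → 𝔽^ m → 𝔽^ m → ℕ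
  _·_ {m} a c = ∑ m (λ i → toℕ (a i) * toℕ (c i))

  ·-comm : ∀ {m} (a c : 𝔽^ m) → a · c ≡ c · a
  ·-comm {m} a c = ∑-cong m (λ i → *-comm (toℕ (a i)) (toℕ (c i)))

  ·-congˡ : ∀ {m} {a a′ : 𝔽^ m} → (∀ i → a i ≡ a′ i) → ∀ c → a · c ≡ a′ · c
  ·-congˡ {m} a≗a′ c = ∑-cong m (λ i → cong (λ x → toℕ x * toℕ (c i)) (a≗a′ i))

  χ : ℕ → ℕ
  χ x with p ∣? x
  ... | yes _ = 0
  ... | no  _ = 1

  χ-∣ : ∀ {x} → p ∣ x → χ x ≡ 0
  χ-∣ {x} p∣x with p ∣? x
  ... | yes _   = refl
  ... | no  p∤x = contradiction p∣x p∤x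

  χ-∤ : ∀ {x} → ¬ p ∣ x → χ x ≡ 1
  χ-∤ {x} p∤x with p ∣? x
  ... | yes p∣x = contradiction p∣x p∤x
  ... | no  _   = refl

  χ≡0⇒∣ : ∀ {x} → χ x ≡ 0 → p ∣ x
  χ≡0⇒∣ {x} χx≡0 with p ∣? x
  ... | yes p∣x = p∣x

  χ≤1 : ∀ x → χ x ≤ 1
  χ≤1 x with p ∣? x
  ... | yes _ = z≤n
  ... | no  _ = s≤s z≤n

  χ-cong-% : ∀ {x y} → x % p ≡ y % p → χ x ≡ χ y
  χ-cong-% {x} {y} x≡y with p ∣? x
  ... | yes p∣x = sym (χ-∣ (m%n≡0⇒n∣m y p (trans (sym x≡y) (n∣m⇒m%n≡0 x p p∣x))))
  ... | no  p∤x = sym (χ-∤ λ p∣y → p∤x (m%n≡0⇒n∣m x p (trans x≡y (n∣m⇒m%n≡0 y p p∣y))))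

  weightOn : ∀ {m} → 𝔽^ m → List (𝔽^ m) → ℕ
  weightOn a []       = 0
  weightOn a (c ∷ cs) = χ (a · c) + weightOn a cs

  weightOn-++ : ∀ {m} (a : 𝔽^ m) cs ds → weightOn a (cs ++ ds) ≡ weightOn a cs + weightOn a ds
  weightOn-++ a []       ds = refl
  weightOn-++ a (c ∷ cs) ds =
    trans (cong (χ (a · c) +_) (weightOn-++ a cs ds)) (sym (+-assoc (χ (a · c)) _ _))

  weightOn-tabulate : ∀ {m} n (a : 𝔽^ m) (f : Fin n → 𝔽^ m) →
                      weightOn a (L.tabulate f) ≡ ∑ n (λ j → χ (a · f j))
  weightOn-tabulate zero    a f = refl
  weightOn-tabulate (suc n) a f = cong (χ (a · f F.zero) +_) (weightOn-tabulate n a (tail f))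

  weightOn-congˡ : ∀ {m} {a a′ : 𝔽^ m} → (∀ i → a i ≡ a′ i) → ∀ cs → weightOn a cs ≡ weightOn a′ cs
  weightOn-congˡ a≗a′ []       = refl
  weightOn-congˡ a≗a′ (c ∷ cs) = cong₂ _+_ (cong χ (·-congˡ a≗a′ c)) (weightOn-congˡ a≗a′ cs)

  columns : ∀ {m n} → Matrix p m n → List (𝔽^ m)
  columns M = L.tabulate (λ j i → M i j)

  count≡∑χ : ∀ n (g : Fin n → ℕ) → count n (λ j → ¬ p ∣ g j) (λ j → ¬? (p ∣? g j)) ≡ ∑ n (χ ∘ g)
  count≡∑χ zero    g = refl
  count≡∑χ (suc n) g with p ∣? g F.zero
  ... | yes _ = count≡∑χ n (tail g)
  ... | no  _ = cong suc (count≡∑χ n (tail g))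

  weight≡weightOn-columns : ∀ {m n} (a : 𝔽^ m) (M : Matrix p m n) → weight a M ≡ weightOn a (columns M)
  weight≡weightOn-columns {n = n} a M =
    trans (count≡∑χ n (combℕ a M)) (sym (weightOn-tabulate n a (λ j i → M i j)))

  addScaled : ∀ {m} → 𝔽^ m → Fin p → 𝔽^ m → 𝔽^ m
  addScaled a x h i = (toℕ (a i) + toℕ x * toℕ (h i)) mod p

  ·-addScaled : ∀ {m} (a : 𝔽^ m) x h c → (addScaled a x h · c) % p ≡ (a · c + toℕ x * (h · c)) % p
  ·-addScaled {m} a x h c = trans (∑-cong-% m termwise) (cong (_% p) (begin
    ∑ m (λ i → toℕ (a i) * toℕ (c i) + toℕ x * toℕ (h i) * toℕ (c i))
      ≡⟨ ∑-distrib-+ m _ _ ⟩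
    a · c + ∑ m (λ i → toℕ x * toℕ (h i) * toℕ (c i))
      ≡⟨ cong (a · c +_) (∑-cong m (λ i → *-assoc (toℕ x) (toℕ (h i)) (toℕ (c i)))) ⟩
    a · c + ∑ m (λ i → toℕ x * (toℕ (h i) * toℕ (c i)))
      ≡⟨ cong (a · c +_) (∑-distribˡ-* m (toℕ x) _) ⟩
    a · c + toℕ x * (h · c) ∎))
    where
    open ≡-Reasoning
    termwise : ∀ i → (toℕ (addScaled a x h i) * toℕ (c i)) % p ≡
                     (toℕ (a i) * toℕ (c i) + toℕ x * toℕ (h i) * toℕ (c i)) % p
    termwise i = begin
      (toℕ (addScaled a x h i) * toℕ (c i)) % p       ≡⟨ cong (λ y → (y * toℕ (c i)) % p) (toℕ-fromℕ< (m%n<n s p)) ⟩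
      (s % p * toℕ (c i)) % p                         ≡⟨ [m%d*n]%d≡[m*n]%d s (toℕ (c i)) ⟩
      (s * toℕ (c i)) % p                             ≡⟨ cong (_% p) (*-distribʳ-+ (toℕ (c i)) (toℕ (a i)) _) ⟩
      (toℕ (a i) * toℕ (c i) + toℕ x * toℕ (h i) * toℕ (c i)) % p ∎
      where s = toℕ (a i) + toℕ x * toℕ (h i)

  χ-addScaled-∣ : ∀ {m} (a h c : 𝔽^ m) → p ∣ h · c → ∀ x → χ (addScaled a x h · c) ≡ χ (a · c)
  χ-addScaled-∣ a h c p∣h·c x =
    χ-cong-% (trans (·-addScaled a x h c) (%-remove-+ʳ (a · c) (∣n⇒∣m*n (toℕ x) p∣h·c)))

  χ-addScaled-∤ : ∀ {m} (a h c : 𝔽^ m) → ¬ p ∣ h · c → suc r ≤ ∑ p (λ x → χ (addScaled a x h · c))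
  χ-addScaled-∤ a h c p∤h·c = s≤s⁻¹ (≤suc∑-if-unique-zero p (λ x → χ (addScaled a x h · c)) unique-zero)
    where
    vanishes : ∀ x → χ (addScaled a x h · c) ≡ 0 → (a · c + toℕ x * (h · c)) % p ≡ 0
    vanishes x χ≡0 = trans (sym (·-addScaled a x h c)) (n∣m⇒m%n≡0 _ p (χ≡0⇒∣ χ≡0))
    unique-zero : ∀ x₁ x₂ → χ (addScaled a x₁ h · c) ≡ 0 → χ (addScaled a x₂ h · c) ≡ 0 → x₁ ≡ x₂
    unique-zero x₁ x₂ z₁ z₂ = scaled-injective (a · c) p∤h·c x₁ x₂ (trans (vanishes x₁ z₁) (sym (vanishes x₂ z₂)))

  kernel : ∀ {m} → 𝔽^ m → List (𝔽^ m) → List (𝔽^ m)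
  kernel h []       = []
  kernel h (c ∷ cs) with p ∣? h · c
  ... | yes _ = c ∷ kernel h cs
  ... | no  _ = kernel h cs

  All-kernel : ∀ {m} {P : 𝔽^ m → Set} (h : 𝔽^ m) {cs} → All P cs → All P (kernel h cs)
  All-kernel h []                     = []
  All-kernel h {c ∷ cs} (Pc ∷ Pcs) with p ∣? h · c
  ... | yes _ = Pc ∷ All-kernel h Pcs
  ... | no  _ = All-kernel h Pcs

  length-kernel : ∀ {m} (h : 𝔽^ m) cs → length (kernel h cs) + weightOn h cs ≡ length cs
  length-kernel h []       = refl
  length-kernel h (c ∷ cs) with p ∣? h · c
  ... | yes _ = cong suc (length-kernel h cs)
  ... | no  _ = trans (+-suc _ _) (cong suc (length-kernel h cs))

  -- Here suc r = p − 1: each column outside the kernel of h is killed by exactly one of the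
  -- p functionals a + x h, and each column inside it sees the same value under all of them.
  averaging : ∀ {m} (a h : 𝔽^ m) cs →
              p * weightOn a (kernel h cs) + suc r * weightOn h cs ≤ ∑ p (λ x → weightOn (addScaled a x h) cs)
  averaging a h [] rewrite *-zeroʳ p = z≤n
  averaging a h (c ∷ cs) with p ∣? h · c
  ... | yes p∣h·c = begin
    p * (χ (a · c) + wK) + suc r * wH                  ≡⟨ regroup p (χ (a · c)) wK (suc r * wH) ⟩
    p * χ (a · c) + (p * wK + suc r * wH)              ≤⟨ +-monoʳ-≤ (p * χ (a · c)) (averaging a h cs) ⟩
    p * χ (a · c) + ∑ p (λ x → weightOn (addScaled a x h) cs)
      ≡⟨ cong (_+ ∑ p (λ x → weightOn (addScaled a x h) cs)) constant ⟨
    ∑ p (λ x → χ (addScaled a x h · c)) + ∑ p (λ x → weightOn (addScaled a x h) cs)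
      ≡⟨ ∑-distrib-+ p (λ x → χ (addScaled a x h · c)) (λ x → weightOn (addScaled a x h) cs) ⟨
    ∑ p (λ x → weightOn (addScaled a x h) (c ∷ cs)) ∎
    where
    open ≤-Reasoning
    wK = weightOn a (kernel h cs)
    wH = weightOn h cs
    constant : ∑ p (λ x → χ (addScaled a x h · c)) ≡ p * χ (a · c)
    constant = trans (∑-cong p (χ-addScaled-∣ a h c p∣h·c)) (∑-const p (χ (a · c)))
    regroup : ∀ q x y z → q * (x + y) + z ≡ q * x + (q * y + z)
    regroup = solve-∀
  ... | no  p∤h·c = begin
    p * wK + suc r * (1 + wH)                          ≡⟨ regroup p (suc r) wK wH ⟩
    suc r + (p * wK + suc r * wH)                      ≤⟨ +-mono-≤ (χ-addScaled-∤ a h c p∤h·c) (averaging a h cs) ⟩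
    ∑ p (λ x → χ (addScaled a x h · c)) + ∑ p (λ x → weightOn (addScaled a x h) cs)
      ≡⟨ ∑-distrib-+ p (λ x → χ (addScaled a x h · c)) (λ x → weightOn (addScaled a x h) cs) ⟨
    ∑ p (λ x → weightOn (addScaled a x h) (c ∷ cs)) ∎
    where
    open ≤-Reasoning
    wK = weightOn a (kernel h cs)
    wH = weightOn h cs
    regroup : ∀ q s x y → q * x + s * (1 + y) ≡ s + (q * x + s * y)
    regroup = solve-∀

  0ᵛ : ∀ {m} → 𝔽^ m
  0ᵛ _ = F.zero

  1ₚ : Fin p
  1ₚ = F.suc F.zero

  -- Coordinates are addressed by natural numbers; updating a coordinate J ≥ m does nothing.
  _[_]≔_ : ∀ {m} → 𝔽^ m → ℕ → Fin p → 𝔽^ m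
  (v [ J ]≔ x) i = if does (toℕ i ≟ J) then x else v i

  coeff : ∀ {m} → 𝔽^ m → ℕ → ℕ
  coeff {m} a J = ∑ m (λ i → if does (toℕ i ≟ J) then toℕ (a i) else 0)

  e : ∀ {m} → ℕ → 𝔽^ m
  e J = 0ᵛ [ J ]≔ 1ₚ

  ·-0ᵛ : ∀ {m} (a : 𝔽^ m) → a · 0ᵛ ≡ 0
  ·-0ᵛ {m} a = trans (∑-cong m (λ i → *-zeroʳ (toℕ (a i)))) (trans (∑-const m 0) (*-zeroʳ m))

  ·-update : ∀ {m} (a v : 𝔽^ m) J x → a · (v [ J ]≔ x) ≡ (a [ J ]≔ F.zero) · v + coeff a J * toℕ x
  ·-update {m} a v J x = begin
    a · (v [ J ]≔ x)                                                    ≡⟨ ∑-cong m (λ i → split (does (toℕ i ≟ J)) (a i) (v i)) ⟩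
    ∑ m (λ i → toℕ ((a [ J ]≔ F.zero) i) * toℕ (v i) + (if does (toℕ i ≟ J) then toℕ (a i) else 0) * toℕ x)
                                                                        ≡⟨ ∑-distrib-+ m _ _ ⟩
    (a [ J ]≔ F.zero) · v + ∑ m (λ i → (if does (toℕ i ≟ J) then toℕ (a i) else 0) * toℕ x)
                                                                        ≡⟨ cong ((a [ J ]≔ F.zero) · v +_) (∑-distribʳ-* m (toℕ x) _) ⟩
    (a [ J ]≔ F.zero) · v + coeff a J * toℕ x                           ∎
    where
    open ≡-Reasoning
    split : ∀ b (aᵢ vᵢ : Fin p) → toℕ aᵢ * toℕ (if b then x else vᵢ) ≡
            toℕ (if b then F.zero else aᵢ) * toℕ vᵢ + (if b then toℕ aᵢ else 0) * toℕ x
    split true  aᵢ vᵢ = refl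
    split false aᵢ vᵢ = sym (+-identityʳ _)

  ·-e : ∀ {m} (a : 𝔽^ m) J → a · e J ≡ coeff a J
  ·-e a J = trans (·-update a 0ᵛ J 1ₚ) (trans (cong (_+ coeff a J * 1) (·-0ᵛ (a [ J ]≔ F.zero))) (*-identityʳ (coeff a J)))

  coeff-toℕ : ∀ {m} (a : 𝔽^ m) i → coeff a (toℕ i) ≡ toℕ (a i)
  coeff-toℕ {suc m} a F.zero    = trans (cong (toℕ (a F.zero) +_) (trans (∑-const m 0) (*-zeroʳ m))) (+-identityʳ _)
  coeff-toℕ {suc m} a (F.suc i) = coeff-toℕ (tail a) i

  e·-toℕ : ∀ {m} i (c : 𝔽^ m) → e (toℕ i) · c ≡ toℕ (c i)
  e·-toℕ i c = trans (·-comm (e (toℕ i)) c) (trans (·-e c (toℕ i)) (coeff-toℕ c i))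

  maximizer : ∀ m (f : 𝔽^ m → ℕ) → (∀ {a a′} → (∀ i → a i ≡ a′ i) → f a ≡ f a′) →
              ∃ λ h → ∀ a → f a ≤ f h
  maximizer zero    f f-cong = (λ ()) , λ a → ≤-reflexive (f-cong (λ ()))
  maximizer (suc m) f f-cong = x ◂ best x , λ a → begin
    f a                              ≡⟨ f-cong (λ { F.zero → refl ; (F.suc i) → refl }) ⟩
    f (a F.zero ◂ tail a)            ≤⟨ proj₂ (fiber (a F.zero)) (tail a) ⟩
    f (a F.zero ◂ best (a F.zero))   ≤⟨ proj₂ top (a F.zero) ⟩
    f (x ◂ best x)                   ∎
    where
    open ≤-Reasoning
    fiber : ∀ y → ∃ λ t → ∀ s → f (y ◂ s) ≤ f (y ◂ t)
    fiber y = maximizer m (λ s → f (y ◂ s)) (λ s≗s′ → f-cong λ { F.zero → refl ; (F.suc i) → s≗s′ i })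
    best : Fin p → 𝔽^ m
    best y = proj₁ (fiber y)
    top : ∃ λ x → ∀ y → f (y ◂ best y) ≤ f (x ◂ best x)
    top = maximizer-Fin (suc r) (λ y → f (y ◂ best y))
    x : Fin p
    x = proj₁ top

  NonZeroVec : ∀ {m} → 𝔽^ m → Set
  NonZeroVec {m} c = ∃ λ (i : Fin m) → toℕ (c i) ≢ 0

  p*weightOn-kernel≤ : ∀ {m} (h : 𝔽^ m) cs → (∀ a → weightOn a cs ≤ weightOn h cs) →
                       ∀ a → p * weightOn a (kernel h cs) ≤ weightOn h cs
  p*weightOn-kernel≤ h cs h-max a = +-cancelʳ-≤ (suc r * t) (p * weightOn a (kernel h cs)) t (begin
    p * weightOn a (kernel h cs) + suc r * t          ≤⟨ averaging a h cs ⟩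
    ∑ p (λ x → weightOn (addScaled a x h) cs)         ≤⟨ ∑-≤-const p t (λ x → h-max (addScaled a x h)) ⟩
    p * t                                             ∎)
    where
    open ≤-Reasoning
    t = weightOn h cs

  length≤floorSum : ∀ {m} fuel (cs : List (𝔽^ m)) → length cs ≤ fuel → All NonZeroVec cs →
                    ∀ c → (∀ a → weightOn a cs ≤ c) → length cs ≤ floorSum c
  length≤floorSum _ [] _ _ _ _ = z≤n
  length≤floorSum {m} (suc fuel) cs@(c₀ ∷ _) (s≤s len≤fuel) nonzero@((i , c₀ᵢ≢0) ∷ _) c ≤c = begin
    length cs                     ≡⟨ length-kernel h cs ⟨
    length (kernel h cs) + t      ≤⟨ +-monoˡ-≤ t (length≤floorSum fuel (kernel h cs) kernel-length (All-kernel h nonzero) (t / p) kernel-weight) ⟩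
    floorSum (t / p) + t          ≡⟨ +-comm (floorSum (t / p)) t ⟩
    t + floorSum (t / p)          ≡⟨ floorSum-unfold t ⟨
    floorSum t                    ≤⟨ floorSum-mono (≤c h) ⟩
    floorSum c                    ∎
    where
    open ≤-Reasoning
    best : ∃ λ h → ∀ a → weightOn a cs ≤ weightOn h cs
    best = maximizer m (λ a → weightOn a cs) (λ a≗a′ → weightOn-congˡ a≗a′ cs)
    h : 𝔽^ m
    h = proj₁ best
    t : ℕ
    t = weightOn h cs
    t≥1 : 1 ≤ t
    t≥1 = begin
      1                                 ≡⟨ χ-∤ p∤eᵢ·c₀ ⟨
      χ (e (toℕ i) · c₀)                ≤⟨ m≤m+n _ _ ⟩
      weightOn (e (toℕ i)) cs           ≤⟨ proj₂ best (e (toℕ i)) ⟩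
      t                                 ∎
      where
      p∤eᵢ·c₀ : ¬ p ∣ e (toℕ i) · c₀
      p∤eᵢ·c₀ p∣ = c₀ᵢ≢0 (∣-<⇒≡0 (toℕ<n (c₀ i)) (subst (p ∣_) (e·-toℕ i c₀) p∣))
    kernel-length : length (kernel h cs) ≤ fuel
    kernel-length = +-cancelʳ-≤ 1 (length (kernel h cs)) fuel (begin
      length (kernel h cs) + 1          ≤⟨ +-monoʳ-≤ (length (kernel h cs)) t≥1 ⟩
      length (kernel h cs) + t          ≡⟨ length-kernel h cs ⟩
      length cs                         ≤⟨ s≤s len≤fuel ⟩
      suc fuel                          ≡⟨ +-comm 1 fuel ⟩
      fuel + 1                          ∎)
    kernel-weight : ∀ a → weightOn a (kernel h cs) ≤ t / p
    kernel-weight a = begin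
      w                                 ≡⟨ m*n/n≡m w p ⟨
      w * p / p                         ≡⟨ cong (_/ p) (*-comm w p) ⟩
      p * w / p                         ≤⟨ /-monoˡ-≤ p (p*weightOn-kernel≤ h cs (proj₂ best) a) ⟩
      t / p                             ∎
      where w = weightOn a (kernel h cs)

  n≤floorSum-capacity : ∀ {m n} (M : Matrix p m n) c → NoZeroColumn M → (∀ a → weight a M ≤ c) → n ≤ floorSum c
  n≤floorSum-capacity {n = n} M c noZero ≤c =
    subst (_≤ floorSum c) (length-tabulate (λ j i → M i j))
      (length≤floorSum n (columns M) (≤-reflexive (length-tabulate (λ j i → M i j))) (Allₚ.tabulate⁺ noZero) c
        (λ a → subst (_≤ c) (weight≡weightOn-columns a M) (≤c a)))

  extend : ∀ {m} → ℕ → List (𝔽^ m) → List (𝔽^ m)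
  extend J []       = []
  extend J (v ∷ vs) = L.tabulate (v [ J ]≔_) ++ extend J vs

  -- The points of the projective space PG(j, p), as the vectors supported on coordinates
  -- 0, …, j whose first nonzero coordinate is 1.
  PG : ∀ {m} → ℕ → List (𝔽^ m)
  PG zero    = e 0 ∷ []
  PG (suc j) = e (suc j) ∷ extend (suc j) (PG j)

  length-extend : ∀ {m} J (vs : List (𝔽^ m)) → length (extend J vs) ≡ length vs * p
  length-extend J []       = refl
  length-extend J (v ∷ vs) =
    trans (length-++ (L.tabulate (v [ J ]≔_))) (cong₂ _+_ (length-tabulate (v [ J ]≔_)) (length-extend J vs))

  length-PG : ∀ {m} j → length (PG {m} j) ≡ σ p j
  length-PG zero    = refl
  length-PG (suc j) = begin
    1 + length (extend (suc j) (PG j))    ≡⟨ cong suc (length-extend (suc j) (PG j)) ⟩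
    1 + length (PG j) * p                 ≡⟨ cong (λ l → 1 + l * p) (length-PG j) ⟩
    1 + σ p j * p                         ≡⟨ cong suc (*-comm (σ p j) p) ⟩
    1 + p * σ p j                         ≡⟨ σ-sucˡ j ⟨
    σ p (suc j)                           ∎
    where open ≡-Reasoning

  weightOn-extend-∣ : ∀ {m} (a : 𝔽^ m) J vs → p ∣ coeff a J →
                      weightOn a (extend J vs) ≡ p * weightOn (a [ J ]≔ F.zero) vs
  weightOn-extend-∣ a J []       p∣aⱼ = sym (*-zeroʳ p)
  weightOn-extend-∣ a J (v ∷ vs) p∣aⱼ = begin
    weightOn a (L.tabulate (v [ J ]≔_) ++ extend J vs)
      ≡⟨ weightOn-++ a (L.tabulate (v [ J ]≔_)) (extend J vs) ⟩
    weightOn a (L.tabulate (v [ J ]≔_)) + weightOn a (extend J vs)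
      ≡⟨ cong₂ _+_ (weightOn-tabulate p a (v [ J ]≔_)) (weightOn-extend-∣ a J vs p∣aⱼ) ⟩
    ∑ p (λ x → χ (a · (v [ J ]≔ x))) + p * weightOn a′ vs
      ≡⟨ cong (_+ p * weightOn a′ vs) (trans (∑-cong p χ-update) (∑-const p (χ (a′ · v)))) ⟩
    p * χ (a′ · v) + p * weightOn a′ vs
      ≡⟨ *-distribˡ-+ p (χ (a′ · v)) (weightOn a′ vs) ⟨
    p * weightOn a′ (v ∷ vs) ∎
    where
    open ≡-Reasoning
    a′ = a [ J ]≔ F.zero
    χ-update : ∀ x → χ (a · (v [ J ]≔ x)) ≡ χ (a′ · v)
    χ-update x = trans (cong χ (·-update a v J x))
                       (χ-cong-% (%-remove-+ʳ (a′ · v) (∣m⇒∣m*n (toℕ x) p∣aⱼ)))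

  weightOn-extend-∤ : ∀ {m} (a : 𝔽^ m) J vs → ¬ p ∣ coeff a J → weightOn a (extend J vs) ≤ length vs * suc r
  weightOn-extend-∤ a J []       p∤aⱼ = z≤n
  weightOn-extend-∤ a J (v ∷ vs) p∤aⱼ = begin
    weightOn a (L.tabulate (v [ J ]≔_) ++ extend J vs)
      ≡⟨ weightOn-++ a (L.tabulate (v [ J ]≔_)) (extend J vs) ⟩
    weightOn a (L.tabulate (v [ J ]≔_)) + weightOn a (extend J vs)
      ≡⟨ cong (_+ weightOn a (extend J vs)) (weightOn-tabulate p a (v [ J ]≔_)) ⟩
    ∑ p (λ x → χ (a · (v [ J ]≔ x))) + weightOn a (extend J vs)
      ≤⟨ +-mono-≤ one-root (weightOn-extend-∤ a J vs p∤aⱼ) ⟩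
    suc r + length vs * suc r ∎
    where
    open ≤-Reasoning
    root = exists-root p∤aⱼ ((a [ J ]≔ F.zero) · v)
    vanishes : χ (a · (v [ J ]≔ proj₁ root)) ≡ 0
    vanishes = χ-∣ (subst (p ∣_) (sym (trans (·-update a v J (proj₁ root))
                 (cong ((a [ J ]≔ F.zero) · v +_) (*-comm (coeff a J) (toℕ (proj₁ root)))))) (proj₂ root))
    one-root : ∑ p (λ x → χ (a · (v [ J ]≔ x))) ≤ suc r
    one-root = ∑≤-if-≤1-with-zero (suc r) (λ x → χ (a · (v [ J ]≔ x))) (λ x → χ≤1 (a · (v [ J ]≔ x))) (proj₁ root) vanishes

  p^suc≡1+[p-1]σ : ∀ j → p ^ suc j ≡ 1 + suc r * σ p j
  p^suc≡1+[p-1]σ j = +-cancelˡ-≡ (σ p j) _ _ (begin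
    σ p j + p ^ suc j               ≡⟨ σ-sucʳ j ⟨
    σ p (suc j)                     ≡⟨ σ-sucˡ j ⟩
    1 + (σ p j + suc r * σ p j)     ≡⟨ +-suc (σ p j) (suc r * σ p j) ⟨
    σ p j + (1 + suc r * σ p j)     ∎)
    where open ≡-Reasoning

  weightOn-PG : ∀ {m} j (a : 𝔽^ m) → weightOn a (PG j) ≤ p ^ j
  weightOn-PG zero    a = +-monoˡ-≤ 0 (χ≤1 (a · e 0))
  weightOn-PG (suc j) a with p ∣? coeff a (suc j)
  ... | yes p∣aⱼ = begin
    χ (a · e (suc j)) + weightOn a (extend (suc j) (PG j))
      ≡⟨ cong₂ _+_ (χ-∣ (subst (p ∣_) (sym (·-e a (suc j))) p∣aⱼ)) (weightOn-extend-∣ a (suc j) (PG j) p∣aⱼ) ⟩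
    p * weightOn (a [ suc j ]≔ F.zero) (PG j)
      ≤⟨ *-monoʳ-≤ p (weightOn-PG j (a [ suc j ]≔ F.zero)) ⟩
    p ^ suc j ∎
    where open ≤-Reasoning
  ... | no p∤aⱼ = begin
    χ (a · e (suc j)) + weightOn a (extend (suc j) (PG j))
      ≤⟨ +-mono-≤ (χ≤1 (a · e (suc j))) (weightOn-extend-∤ a (suc j) (PG j) p∤aⱼ) ⟩
    1 + length (PG j) * suc r
      ≡⟨ cong (λ l → 1 + l * suc r) (length-PG j) ⟩
    1 + σ p j * suc r
      ≡⟨ cong (1 +_) (*-comm (σ p j) (suc r)) ⟩
    1 + suc r * σ p j
      ≡⟨ p^suc≡1+[p-1]σ j ⟨
    p ^ suc j ∎
    where open ≤-Reasoning

  NonZeroWithin : ∀ {m} → ℕ → 𝔽^ m → Set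
  NonZeroWithin {m} j v = ∃ λ (i : Fin m) → toℕ i ≤ j × toℕ (v i) ≢ 0

  e-nonZero : ∀ {m} J → J < m → NonZeroWithin J (e {m} J)
  e-nonZero J J<m = F.fromℕ< J<m , ≤-reflexive (toℕ-fromℕ< J<m) , one≢0
    where
    one≢0 : toℕ (e J (F.fromℕ< J<m)) ≢ 0
    one≢0 rewrite dec-true (toℕ (F.fromℕ< J<m) ≟ J) (toℕ-fromℕ< J<m) = λ ()

  update-nonZero : ∀ {m} {j} (v : 𝔽^ m) x → NonZeroWithin j v → NonZeroWithin (suc j) (v [ suc j ]≔ x)
  update-nonZero {j = j} v x (i , i≤j , vᵢ≢0) = i , m≤n⇒m≤1+n i≤j , unchanged
    where
    unchanged : toℕ ((v [ suc j ]≔ x) i) ≢ 0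
    unchanged rewrite dec-false (toℕ i ≟ suc j) (λ i≡1+j → 1+n≰n (subst (_≤ j) i≡1+j i≤j)) = vᵢ≢0

  extend-nonZero : ∀ {m} j {vs : List (𝔽^ m)} → All (NonZeroWithin j) vs → All (NonZeroWithin (suc j)) (extend (suc j) vs)
  extend-nonZero j []                  = []
  extend-nonZero j {v ∷ _} (nz ∷ nzs) =
    Allₚ.++⁺ (Allₚ.tabulate⁺ (λ x → update-nonZero v x nz)) (extend-nonZero j nzs)

  PG-nonZero : ∀ {m} j → j < m → All (NonZeroWithin j) (PG {m} j)
  PG-nonZero zero    0<m  = e-nonZero 0 0<m ∷ []
  PG-nonZero (suc j) j<m  = e-nonZero (suc j) j<m ∷ extend-nonZero j (PG-nonZero j (<-trans (n<1+n j) j<m))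

  weightOn-copies : ∀ {m} (a : 𝔽^ m) c cs → weightOn a (copies c cs) ≡ c * weightOn a cs
  weightOn-copies a zero    cs = refl
  weightOn-copies a (suc c) cs = trans (weightOn-++ a cs (copies c cs)) (cong (weightOn a cs +_) (weightOn-copies a c cs))

  blocks : ∀ {m} K → (Fin K → ℕ) → (Fin K → List (𝔽^ m)) → List (𝔽^ m)
  blocks zero    b P = []
  blocks (suc K) b P = copies (b F.zero) (P F.zero) ++ blocks K (tail b) (tail P)

  length-blocks : ∀ {m} K b (P : Fin K → List (𝔽^ m)) → length (blocks K b P) ≡ ∑ K (λ j → b j * length (P j))
  length-blocks zero    b P = refl
  length-blocks (suc K) b P = trans (length-++ (copies (b F.zero) (P F.zero)))
    (cong₂ _+_ (length-copies (b F.zero) (P F.zero)) (length-blocks K (tail b) (tail P)))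

  weightOn-blocks : ∀ {m} (a : 𝔽^ m) K b P → weightOn a (blocks K b P) ≡ ∑ K (λ j → b j * weightOn a (P j))
  weightOn-blocks a zero    b P = refl
  weightOn-blocks a (suc K) b P = trans (weightOn-++ a (copies (b F.zero) (P F.zero)) _)
    (cong₂ _+_ (weightOn-copies a (b F.zero) (P F.zero)) (weightOn-blocks a K (tail b) (tail P)))

  All-blocks : ∀ {m} {Q : 𝔽^ m → Set} K b P → (∀ j → 1 ≤ b j → All Q (P j)) → All Q (blocks K b P)
  All-blocks zero    b P _      = []
  All-blocks (suc K) b P All-Q = Allₚ.++⁺ (All-copies (b F.zero) (All-Q F.zero)) (All-blocks K (tail b) (tail P) (All-Q ∘ F.suc))

  n<p^n : ∀ n → n < p ^ n
  n<p^n zero    = s≤s z≤n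
  n<p^n (suc n) = begin-strict
    suc n          ≤⟨ n<p^n n ⟩
    p ^ n          <⟨ m<m*n (p ^ n) p {{m^n≢0 p n}} 1<p ⟩
    p ^ n * p      ≡⟨ *-comm (p ^ n) p ⟩
    p * p ^ n      ∎
    where open ≤-Reasoning

  design : ∀ n k b → n ≡ σ-expansion (suc k) b →
           Σ (Matrix p n n) λ M → NoZeroColumn M × (∀ a → weight a M ≤ p-expansion (suc k) b)
  design n k b n≡N = M , noZero , bounded
    where
    PGs : Fin (suc k) → List (𝔽^ n)
    PGs j = PG (toℕ j)
    cs : List (𝔽^ n)
    cs = blocks (suc k) b PGs
    length-cs : length cs ≡ n
    length-cs = trans (length-blocks (suc k) b PGs)
                      (trans (∑-cong (suc k) (λ j → cong (b j *_) (length-PG {n} (toℕ j)))) (sym n≡N))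
    M : Matrix p n n
    M i j = L.lookup cs (F.cast (sym length-cs) j) i
    columns-M : columns M ≡ cs
    columns-M = tabulate-lookup-cast cs length-cs
    used-index : ∀ j → 1 ≤ b j → toℕ j < n
    used-index j bⱼ≥1 = begin-strict
      toℕ j                            <⟨ σ>index (toℕ j) ⟩
      σ p (toℕ j)                      ≤⟨ m≤n*m (σ p (toℕ j)) (b j) {{>-nonZero bⱼ≥1}} ⟩
      b j * σ p (toℕ j)                ≤⟨ term≤∑ (suc k) (λ i → b i * σ p (toℕ i)) j ⟩
      σ-expansion (suc k) b            ≡⟨ n≡N ⟨
      n                                ∎
      where open ≤-Reasoning
    noZero : NoZeroColumn M
    noZero = Allₚ.tabulate⁻ (subst (All NonZeroVec) (sym columns-M)
      (All-blocks (suc k) b PGs λ j bⱼ≥1 → All.map (λ (i , _ , nz) → i , nz) (PG-nonZero (toℕ j) (used-index j bⱼ≥1))))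
    bounded : ∀ a → weight a M ≤ p-expansion (suc k) b
    bounded a = begin
      weight a M                                       ≡⟨ weight≡weightOn-columns a M ⟩
      weightOn a (columns M)                           ≡⟨ cong (weightOn a) columns-M ⟩
      weightOn a cs                                    ≡⟨ weightOn-blocks a (suc k) b PGs ⟩
      ∑ (suc k) (λ j → b j * weightOn a (PG (toℕ j)))  ≤⟨ ∑-mono-≤ (suc k) (λ j → *-monoʳ-≤ (b j) (weightOn-PG (toℕ j) a)) ⟩
      p-expansion (suc k) b                            ∎
      where open ≤-Reasoning

  weight-cong : ∀ {m n} (M : Matrix p m n) {a a′} → (∀ i → a i ≡ a′ i) → weight a M ≡ weight a′ M
  weight-cong M {a} {a′} a≗a′ =
    trans (weight≡weightOn-columns a M) (trans (weightOn-congˡ a≗a′ (columns M)) (sym (weight≡weightOn-columns a′ M)))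

  λ-p-expansion : ∀ n k b → IsRep p n k b → 1 ≤ n → IsLambda p n (p-expansion (suc k) b)
  λ-p-expansion n k b (b≤p , below , n≡N) n≥1 =
    (n , M , (n≥1 , <⇒≤ (n<p^n n) , noZero) , (h , ≤-antisym (bounded h) (least M _ noZero (proj₂ best))) , bounded) ,
    λ m M′ c (_ , _ , noZero′) (_ , ≤c) → least M′ c noZero′ ≤c
    where
    least : ∀ {m} (M : Matrix p m n) c → NoZeroColumn M → (∀ a → weight a M ≤ c) → p-expansion (suc k) b ≤ c
    least M c noZero ≤c = p-expansion-least (suc k) b c (b≤p , below)
      (subst (_≤ floorSum c) n≡N (n≤floorSum-capacity M c noZero ≤c))
    built : Σ (Matrix p n n) λ M → NoZeroColumn M × (∀ a → weight a M ≤ p-expansion (suc k) b)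
    built = design n k b n≡N
    M : Matrix p n n
    M = proj₁ built
    noZero : NoZeroColumn M
    noZero = proj₁ (proj₂ built)
    bounded : ∀ a → weight a M ≤ p-expansion (suc k) b
    bounded = proj₂ (proj₂ built)
    best : ∃ λ h → ∀ a → weight a M ≤ weight h M
    best = maximizer n (λ a → weight a M) (weight-cong M)
    h : 𝔽^ n
    h = proj₁ best

corollary2p7 : ∀ (p n k : ℕ) → Prime p → 1 ≤ n → n < σ p (suc k) →
    (Σ (Fin (suc k) → ℕ) λ b → IsRep p n k b)
    × (∀ (b : Fin (suc k) → ℕ) → IsRep p n k b →
         IsLambda p n (∑ (suc k) (λ j → b j * p ^ toℕ j)))
corollary2p7 zero          n k p-prime = contradiction p-prime ¬prime[0]
corollary2p7 (suc zero)    n k p-prime = contradiction p-prime ¬prime[1]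
corollary2p7 (suc (suc r)) n k p-prime n≥1 n<σ =
  Radix.representation-exists r k n n<σ , λ b rep → PrimeField.λ-p-expansion r p-prime n k b rep n≥1
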